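{- Let $a_1 \geq 2$ be an integer and let \[ X(a_1) = \left\{ (x_1,x_2) \in \mathbf{N}^2 : a_1 + 1 \leq x_1 \leq 2a_1 - 1 \leq x_2 < \frac{a_1 x_1}{x_1 - a_1} \right\}. \] If $(x_1,x_2) \in X(a_1)$ and \[ a_2 = \left\lceil \left( \frac{1}{x_1} + \frac{1}{x_2} - \frac{1}{a_1} \right)^{ -1} \right\rceil, \] then \[ \frac{1}{a_1} + \frac{1}{a_2} \leq \frac{1}{x_1} + \frac{1}{x_2} < \frac{1}{a_1} + \frac{1}{a_2 - 1}, \] and the pairs $(a_1,a_2)$ and $(x_1,x_2)$ are 2-term Egyptian underapproximation sequences of $\theta$ for all $\theta \in \left( \frac{1}{x_1} + \frac{1}{x_2},\ \frac{1}{a_1} + \frac{1}{a_2 - 1}\right]$. Moreover, $\frac{1}{a_1} + \frac{1}{a_2} = \frac{1}{x_1} + \frac{1}{x_2}$ if and only if $a_2 = \left( \frac{1}{x_1} + \frac{1}{x_2} - \frac{1}{a_1}\right)^{ -1}$.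
   Context: $\mathbf{N}$ denotes the positive integers. A pair of integers $(y_1,y_2)$ is a 2-term Egyptian underapproximation sequence of $\theta$ if $2 \leq y_1 \leq y_2$ and $\frac{1}{y_1} + \frac{1}{y_2} < \theta$.
   Formalization: The number θ in the underapproximation clause ranges over the rationals. -}

module Defs where

open import Data.Integer as ℤ using (ℤ; +_)
open import Data.Rational using (ℚ; 0ℚ; _/_; _+_; _<_; 1/_; ≢-nonZero)
open import Data.Rational.Properties using (_≟_)
open import Data.Product using (_×_)
open import Data.Nat using (ℕ)
open import Relation.Nullary using (yes; no)

ℤ→ℚ : ℤ → ℚ
ℤ→ℚ z = z / 1

ℕ→ℚ : ℕ → ℚ
ℕ→ℚ n = (+ n) / 1

-- total reciprocal: inv p = 1/p for p ≠ 0 (inv 0 = 0, never used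
-- in the statement where the argument is nonzero)
inv : ℚ → ℚ
inv p with p ≟ 0ℚ
... | yes _ = 0ℚ
... | no p≢0 = 1/_ p {{≢-nonZero p≢0}}

EgyptUnder2 : ℚ → ℤ → ℤ → Set
EgyptUnder2 θ y₁ y₂ =
  (+ 2 ℤ.≤ y₁) × (y₁ ℤ.≤ y₂) × (inv (ℤ→ℚ y₁) + inv (ℤ→ℚ y₂) < θ)

-- Put d = 1/x₁ + 1/x₂ − 1/a₁.  The bound x₂ < a₁x₁/(x₁ − a₁) says exactly
-- that d > 0, and x₁, x₂ > a₁ give d < 1/a₁.  Hence a₂ = ⌈1/d⌉ satisfies
-- a₂ − 1 < 1/d ≤ a₂, i.e. 1/a₂ ≤ d < 1/(a₂ − 1), and a₂ > a₁ ≥ 2 keeps every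
-- denominator positive.  Adding 1/a₁ gives the bracket, from which the
-- Egyptian underapproximation claims and the equality case are immediate.
module Submission where

open import Defs
open import Data.Nat as ℕ using (ℕ)
open import Data.Integer as ℤ using (ℤ; +_)
open import Data.Rational using (ℚ; _+_; _-_; _*_; _<_; _≤_; ceiling)
open import Data.Product using (_×_; _,_)
open import Function.Bundles using (_⇔_; mk⇔)
open import Relation.Binary.PropositionalEquality
  using (_≡_; _≢_; refl; sym; trans; cong; cong₂; subst; subst₂; module ≡-Reasoning)
open import Data.Empty using (⊥-elim)
open import Relation.Nullary using (yes; no)
import Data.Nat.Properties as ℕP
import Data.Nat.Coprimality as Coprime
import Data.Integer.Properties as ℤP
import Data.Integer.DivMod as ℤD
open import Data.Integer.Solver using (module +-*-Solver)
open import Data.Rational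
  using (mkℚ; -_; 0ℚ; 1ℚ; 1/_; *<*; *≤*; positive; ≢-nonZero)
open import Data.Rational.Properties using (_≟_; normalize-coprime)
import Data.Rational.Properties as ℚP
import Data.Rational.Solver as ℚSolver
open import Algebra.Properties.Group ℚP.+-0-group using () renaming (∙-cancelˡ to +-cancelˡ)

ℤ→ℚ≡mkℚ : ∀ i → ℤ→ℚ i ≡ mkℚ i 0 (Coprime.sym (Coprime.1-coprimeTo ℤ.∣ i ∣))
ℤ→ℚ≡mkℚ (+ n)      = normalize-coprime (Coprime.sym (Coprime.1-coprimeTo n))
ℤ→ℚ≡mkℚ ℤ.-[1+ n ] = cong -_ (normalize-coprime (Coprime.sym (Coprime.1-coprimeTo (ℕ.suc n))))

ℤ→ℚ-mono-< : ∀ {i j} → i ℤ.< j → ℤ→ℚ i < ℤ→ℚ j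
ℤ→ℚ-mono-< {i} {j} i<j rewrite ℤ→ℚ≡mkℚ i | ℤ→ℚ≡mkℚ j =
  *<* (ℤP.*-monoʳ-<-pos ℤ.1ℤ i<j)

ℤ→ℚ-cancel-< : ∀ {i j} → ℤ→ℚ i < ℤ→ℚ j → i ℤ.< j
ℤ→ℚ-cancel-< {i} {j} i<j rewrite ℤ→ℚ≡mkℚ i | ℤ→ℚ≡mkℚ j with i<j
... | *<* i*1<j*1 = ℤP.*-cancelʳ-<-nonNeg ℤ.1ℤ i*1<j*1

ℕ→ℚ-mono-< : ∀ {m n} → m ℕ.< n → ℕ→ℚ m < ℕ→ℚ n
ℕ→ℚ-mono-< m<n = ℤ→ℚ-mono-< (ℤ.+<+ m<n)

ℕ→ℚ-mono-≤ : ∀ {m n} → m ℕ.≤ n → ℕ→ℚ m ≤ ℕ→ℚ n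
ℕ→ℚ-mono-≤ {m} {n} m≤n rewrite ℤ→ℚ≡mkℚ (+ m) | ℤ→ℚ≡mkℚ (+ n) =
  *≤* (ℤP.*-monoʳ-≤-nonNeg ℤ.1ℤ (ℤ.+≤+ m≤n))

ceiling-mkℚ : ∀ n d .(c : Coprime.Coprime ℤ.∣ n ∣ (ℕ.suc d)) →
              ceiling (mkℚ n d c) ≡ ℤ.- ((ℤ.- n) ℤ./ ℤ.+[1+ d ])
ceiling-mkℚ ℤ.-[1+ n ] d c = refl
ceiling-mkℚ (+ 0)      d c = refl
ceiling-mkℚ ℤ.+[1+ n ] d c = refl

module CeilingDiv (n : ℤ) (d : ℕ) where
  D : ℤ
  D = ℤ.+[1+ d ]

  q : ℤ
  q = (ℤ.- n) ℤ./ D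

  n≤-q*D : n ℤ.* ℤ.1ℤ ℤ.≤ (ℤ.- q) ℤ.* D
  n≤-q*D = begin
    n ℤ.* ℤ.1ℤ       ≡⟨ ℤP.*-identityʳ n ⟩
    n                ≡⟨ sym (ℤP.neg-involutive n) ⟩
    ℤ.- (ℤ.- n)      ≤⟨ ℤP.neg-mono-≤ (ℤD.[n/d]*d≤n (ℤ.- n) D) ⟩
    ℤ.- (q ℤ.* D)    ≡⟨ ℤP.neg-distribˡ-* q D ⟩
    (ℤ.- q) ℤ.* D    ∎
    where open ℤP.≤-Reasoning

  [-q-1]*D<n : (ℤ.- q ℤ.- ℤ.1ℤ) ℤ.* D ℤ.< n ℤ.* ℤ.1ℤ
  [-q-1]*D<n = begin-strict
    (ℤ.- q ℤ.- ℤ.1ℤ) ℤ.* D  ≡⟨ solve 2 (λ q D → (:- q :- con ℤ.1ℤ) :* D := :- ((con ℤ.1ℤ :+ q) :* D))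
                                       refl q D ⟩
    ℤ.- (ℤ.suc q ℤ.* D)     <⟨ ℤP.neg-mono-< -n<[q+1]*D ⟩
    ℤ.- (ℤ.- n)             ≡⟨ ℤP.neg-involutive n ⟩
    n                       ≡⟨ sym (ℤP.*-identityʳ n) ⟩
    n ℤ.* ℤ.1ℤ              ∎
    where
    open ℤP.≤-Reasoning
    open +-*-Solver
    -n<[q+1]*D : ℤ.- n ℤ.< ℤ.suc q ℤ.* D
    -n<[q+1]*D rewrite ℤD.div-pos-is-/ℕ (ℤ.- n) (ℕ.suc d) {{_}} =
      ℤD.n<s[n/ℕd]*d (ℤ.- n) (ℕ.suc d)

≤-ceiling : ∀ p → p ≤ ℤ→ℚ (ceiling p)
≤-ceiling (mkℚ n d c) rewrite ceiling-mkℚ n d c | ℤ→ℚ≡mkℚ (ℤ.- CeilingDiv.q n d) =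
  *≤* (CeilingDiv.n≤-q*D n d)

ceiling-1< : ∀ p → ℤ→ℚ (ceiling p ℤ.- + 1) < p
ceiling-1< (mkℚ n d c) rewrite ceiling-mkℚ n d c | ℤ→ℚ≡mkℚ (ℤ.- CeilingDiv.q n d ℤ.- + 1) =
  *<* (CeilingDiv.[-q-1]*D<n n d)

0<⇒≢0 : ∀ {p} → 0ℚ < p → p ≢ 0ℚ
0<⇒≢0 0<p p≡0 = ℚP.<⇒≢ 0<p (sym p≡0)

p<q⇒0<q-p : ∀ {p q} → p < q → 0ℚ < q - p
p<q⇒0<q-p {p} {q} p<q = subst (_< q - p) (ℚP.+-inverseʳ p) (ℚP.+-monoˡ-< (- p) p<q)

inv≡1/ : ∀ p (p≢0 : p ≢ 0ℚ) → inv p ≡ (1/ p) {{≢-nonZero p≢0}}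
inv≡1/ p p≢0 with p ≟ 0ℚ
... | yes p≡0 = ⊥-elim (p≢0 p≡0)
... | no _    = refl

inv-inverseʳ : ∀ {p} → 0ℚ < p → p * inv p ≡ 1ℚ
inv-inverseʳ {p} 0<p rewrite inv≡1/ p (0<⇒≢0 0<p) = ℚP.*-inverseʳ p {{≢-nonZero (0<⇒≢0 0<p)}}

inv-inverseˡ : ∀ {p} → 0ℚ < p → inv p * p ≡ 1ℚ
inv-inverseˡ {p} 0<p = trans (ℚP.*-comm (inv p) p) (inv-inverseʳ 0<p)

inv-pos : ∀ {p} → 0ℚ < p → 0ℚ < inv p
inv-pos {p} 0<p rewrite inv≡1/ p (0<⇒≢0 0<p) =
  ℚP.positive⁻¹ _ {{ℚP.1/pos⇒pos p {{positive 0<p}}}}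

*-inv-cancelʳ : ∀ {p} q → 0ℚ < p → q * inv p * p ≡ q
*-inv-cancelʳ {p} q 0<p =
  trans (ℚP.*-assoc q (inv p) p) (trans (cong (q *_) (inv-inverseˡ 0<p)) (ℚP.*-identityʳ q))

*-inv-unique : ∀ {p q x} → 0ℚ < p → x * p ≡ q → x ≡ q * inv p
*-inv-unique {p} {q} {x} 0<p x*p≡q = begin
  x                ≡⟨ sym (ℚP.*-identityʳ x) ⟩
  x * 1ℚ           ≡⟨ cong (x *_) (sym (inv-inverseʳ 0<p)) ⟩
  x * (p * inv p)  ≡⟨ sym (ℚP.*-assoc x p (inv p)) ⟩
  x * p * inv p    ≡⟨ cong (_* inv p) x*p≡q ⟩
  q * inv p        ∎
  where open ≡-Reasoning

inv-involutive : ∀ {p} → 0ℚ < p → inv (inv p) ≡ p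
inv-involutive {p} 0<p =
  sym (trans (*-inv-unique (inv-pos 0<p) (inv-inverseʳ 0<p)) (ℚP.*-identityˡ _))

inv-antimono-< : ∀ {p q} → 0ℚ < p → p < q → inv q < inv p
inv-antimono-< {p} {q} 0<p p<q = begin-strict
  inv q                  ≡⟨ *-inv-unique 0<p refl ⟩
  inv q * p * inv p      <⟨ ℚP.*-monoˡ-<-pos (inv p) {{positive (inv-pos 0<p)}}
                              (ℚP.*-monoʳ-<-pos (inv q) {{positive (inv-pos 0<q)}} p<q) ⟩
  inv q * q * inv p      ≡⟨ cong (_* inv p) (inv-inverseˡ 0<q) ⟩
  1ℚ * inv p             ≡⟨ ℚP.*-identityˡ (inv p) ⟩
  inv p                  ∎
  where
  open ℚP.≤-Reasoning
  0<q : 0ℚ < q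
  0<q = ℚP.<-trans 0<p p<q

inv-antimono-≤ : ∀ {p q} → 0ℚ < p → p ≤ q → inv q ≤ inv p
inv-antimono-≤ {p} {q} 0<p p≤q with p ≟ q
... | yes refl = ℚP.≤-refl
... | no p≢q   = ℚP.<⇒≤ (inv-antimono-< 0<p (ℚP.≰⇒> (λ q≤p → p≢q (ℚP.≤-antisym p≤q q≤p))))

inv-injective : ∀ {p q} → 0ℚ < p → 0ℚ < q → inv p ≡ inv q → p ≡ q
inv-injective {p} {q} 0<p 0<q eq =
  trans (sym (inv-involutive 0<p)) (trans (cong inv eq) (inv-involutive 0<q))

module CeilingOfInverse {d : ℚ} (0<d : 0ℚ < d) where
  inv-ceiling-inv-≤ : inv (ℤ→ℚ (ceiling (inv d))) ≤ d
  inv-ceiling-inv-≤ = subst (inv (ℤ→ℚ (ceiling (inv d))) ≤_) (inv-involutive 0<d)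
                        (inv-antimono-≤ (inv-pos 0<d) (≤-ceiling (inv d)))

  <-inv-ceiling-inv-1 : 0ℚ < ℤ→ℚ (ceiling (inv d) ℤ.- + 1) →
                        d < inv (ℤ→ℚ (ceiling (inv d) ℤ.- + 1))
  <-inv-ceiling-inv-1 0<c-1 = subst (_< inv (ℤ→ℚ (ceiling (inv d) ℤ.- + 1))) (inv-involutive 0<d)
                                (inv-antimono-< 0<c-1 (ceiling-1< (inv d)))

  <-ceiling-inv : ∀ {i} → 0ℚ < ℤ→ℚ i → d < inv (ℤ→ℚ i) → i ℤ.< ceiling (inv d)
  <-ceiling-inv {i} 0<i d<1/i = ℤ→ℚ-cancel-< (begin-strict
    ℤ→ℚ i                    ≡⟨ sym (inv-involutive 0<i) ⟩
    inv (inv (ℤ→ℚ i))        <⟨ inv-antimono-< 0<d d<1/i ⟩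
    inv d                    ≤⟨ ≤-ceiling (inv d) ⟩
    ℤ→ℚ (ceiling (inv d))    ∎)
    where open ℚP.≤-Reasoning

reciprocal-gap-*-product : ∀ {a p q} → 0ℚ < a → 0ℚ < p → 0ℚ < q →
  (inv p + inv q - inv a) * (a * p * q) ≡ a * p - q * (p - a)
reciprocal-gap-*-product {a} {p} {q} 0<a 0<p 0<q = begin
  (inv p + inv q - inv a) * (a * p * q)
    ≡⟨ solve 6 (λ ip iq ia a p q → (ip :+ iq :- ia) :* (a :* p :* q) :=
         (ip :* p) :* (a :* q) :+ (iq :* q) :* (a :* p) :- (ia :* a) :* (p :* q)) refl
         (inv p) (inv q) (inv a) a p q ⟩
  (inv p * p) * (a * q) + (inv q * q) * (a * p) - (inv a * a) * (p * q)
    ≡⟨ cong₂ _-_ (cong₂ _+_ (cong (_* (a * q)) (inv-inverseˡ 0<p)) (cong (_* (a * p)) (inv-inverseˡ 0<q)))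
                 (cong (_* (p * q)) (inv-inverseˡ 0<a)) ⟩
  1ℚ * (a * q) + 1ℚ * (a * p) - 1ℚ * (p * q)
    ≡⟨ solve 3 (λ a p q → con 1ℚ :* (a :* q) :+ con 1ℚ :* (a :* p) :- con 1ℚ :* (p :* q) :=
         a :* p :- q :* (p :- a)) refl a p q ⟩
  a * p - q * (p - a) ∎
  where
  open ≡-Reasoning
  open ℚSolver.+-*-Solver

reciprocal-gap-pos : ∀ {a p q} → 0ℚ < a → a < p → 0ℚ < q → q < a * p * inv (p - a) →
                     0ℚ < inv p + inv q - inv a
reciprocal-gap-pos {a} {p} {q} 0<a a<p 0<q q<ap/[p-a] =
  ℚP.*-cancelʳ-<-nonNeg (a * p * q) {{ℚP.pos⇒nonNeg (a * p * q) {{positive 0<apq}}}}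
    (subst₂ _<_ (sym (ℚP.*-zeroˡ (a * p * q))) (sym (reciprocal-gap-*-product 0<a 0<p 0<q))
      (p<q⇒0<q-p q[p-a]<ap))
  where
  0<p : 0ℚ < p
  0<p = ℚP.<-trans 0<a a<p
  0<p-a : 0ℚ < p - a
  0<p-a = p<q⇒0<q-p a<p
  0<apq : 0ℚ < a * p * q
  0<apq = ℚP.positive⁻¹ _ {{ℚP.pos*pos⇒pos (a * p) {{ℚP.pos*pos⇒pos a {{positive 0<a}} p {{positive 0<p}}}}
                                            q {{positive 0<q}}}}
  q[p-a]<ap : q * (p - a) < a * p
  q[p-a]<ap = subst (q * (p - a) <_) (*-inv-cancelʳ (a * p) 0<p-a)
                (ℚP.*-monoˡ-<-pos (p - a) {{positive 0<p-a}} q<ap/[p-a])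

reciprocal-gap<inv : ∀ {a p q} → 0ℚ < a → a < p → a < q → inv p + inv q - inv a < inv a
reciprocal-gap<inv {a} {p} {q} 0<a a<p a<q =
  subst (inv p + inv q - inv a <_) (solve 1 (λ x → x :+ x :- x := x) refl (inv a))
    (ℚP.+-monoˡ-< (- inv a) (ℚP.+-mono-< (inv-antimono-< 0<a a<p) (inv-antimono-< 0<a a<q)))
  where open ℚSolver.+-*-Solver

module CeilingCompletion {a : ℤ} {s : ℚ} (0<a : ℤ.0ℤ ℤ.< a)
    (0<d : 0ℚ < s - inv (ℤ→ℚ a)) (d<1/a : s - inv (ℤ→ℚ a) < inv (ℤ→ℚ a)) where
  open CeilingOfInverse 0<d

  A d : ℚ
  A = ℤ→ℚ a
  d = s - inv A

  c : ℤ
  c = ceiling (inv d)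

  s≡1/a+d : s ≡ inv A + d
  s≡1/a+d = solve 2 (λ x y → y := x :+ (y :- x)) refl (inv A) s
    where open ℚSolver.+-*-Solver

  a<c : a ℤ.< c
  a<c = <-ceiling-inv (ℤ→ℚ-mono-< 0<a) d<1/a

  0<c : 0ℚ < ℤ→ℚ c
  0<c = ℤ→ℚ-mono-< (ℤP.<-trans 0<a a<c)

  0<c-1 : 0ℚ < ℤ→ℚ (c ℤ.- + 1)
  0<c-1 = ℤ→ℚ-mono-< (ℤP.<-≤-trans 0<a
            (subst (a ℤ.≤_) (ℤP.+-comm ℤ.-1ℤ c) (ℤP.i<j⇒i≤pred[j] a<c)))

  1/a+1/c≤s : inv A + inv (ℤ→ℚ c) ≤ s
  1/a+1/c≤s = subst (inv A + inv (ℤ→ℚ c) ≤_) (sym s≡1/a+d)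
                (ℚP.+-monoʳ-≤ (inv A) inv-ceiling-inv-≤)

  s<1/a+1/[c-1] : s < inv A + inv (ℤ→ℚ (c ℤ.- + 1))
  s<1/a+1/[c-1] = subst (_< inv A + inv (ℤ→ℚ (c ℤ.- + 1))) (sym s≡1/a+d)
                    (ℚP.+-monoʳ-< (inv A) (<-inv-ceiling-inv-1 0<c-1))

  1/a+1/c≡s⇔c≡1/d : (inv A + inv (ℤ→ℚ c) ≡ s) ⇔ (ℤ→ℚ c ≡ inv d)
  1/a+1/c≡s⇔c≡1/d = mk⇔ exact⇒ ⇐exact
    where
    exact⇒ : inv A + inv (ℤ→ℚ c) ≡ s → ℤ→ℚ c ≡ inv d
    exact⇒ eq = inv-injective 0<c (inv-pos 0<d)
      (trans (+-cancelˡ (inv A) (inv (ℤ→ℚ c)) d (trans eq s≡1/a+d)) (sym (inv-involutive 0<d)))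
    ⇐exact : ℤ→ℚ c ≡ inv d → inv A + inv (ℤ→ℚ c) ≡ s
    ⇐exact eq = begin
      inv A + inv (ℤ→ℚ c)  ≡⟨ cong (λ x → inv A + inv x) eq ⟩
      inv A + inv (inv d)  ≡⟨ cong (λ x → inv A + x) (inv-involutive 0<d) ⟩
      inv A + d            ≡⟨ sym s≡1/a+d ⟩
      s                    ∎
      where open ≡-Reasoning

lemma6p3 : (a₁ x₁ x₂ : ℕ) → 2 ℕ.≤ a₁
    → a₁ ℕ.+ 1 ℕ.≤ x₁ → x₁ ℕ.≤ 2 ℕ.* a₁ ℕ.∸ 1 → 2 ℕ.* a₁ ℕ.∸ 1 ℕ.≤ x₂
    → ℕ→ℚ x₂ < ℕ→ℚ a₁ * ℕ→ℚ x₁ * inv (ℕ→ℚ x₁ - ℕ→ℚ a₁)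
    → (a₂ : ℤ)
    → a₂ ≡ ceiling (inv (inv (ℕ→ℚ x₁) + inv (ℕ→ℚ x₂) - inv (ℕ→ℚ a₁)))
    → ((inv (ℕ→ℚ a₁) + inv (ℤ→ℚ a₂) ≤ inv (ℕ→ℚ x₁) + inv (ℕ→ℚ x₂))
    × (inv (ℕ→ℚ x₁) + inv (ℕ→ℚ x₂) < inv (ℕ→ℚ a₁) + inv (ℤ→ℚ (a₂ ℤ.- + 1))))
    × ((θ : ℚ)
    → inv (ℕ→ℚ x₁) + inv (ℕ→ℚ x₂) < θ
    → θ ≤ inv (ℕ→ℚ a₁) + inv (ℤ→ℚ (a₂ ℤ.- + 1))
    → EgyptUnder2 θ (+ a₁) a₂ × EgyptUnder2 θ (+ x₁) (+ x₂))
    × ((inv (ℕ→ℚ a₁) + inv (ℤ→ℚ a₂) ≡ inv (ℕ→ℚ x₁) + inv (ℕ→ℚ x₂))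
    ⇔ (ℤ→ℚ a₂ ≡ inv (inv (ℕ→ℚ x₁) + inv (ℕ→ℚ x₂) - inv (ℕ→ℚ a₁))))
lemma6p3 a₁ x₁ x₂ 2≤a₁ a₁+1≤x₁ x₁≤2a₁-1 2a₁-1≤x₂ x₂<a₁x₁/[x₁-a₁] a₂ refl =
  (1/a+1/c≤s , s<1/a+1/[c-1]) , egyptian , 1/a+1/c≡s⇔c≡1/d
  where
  a₁<x₁ : a₁ ℕ.< x₁
  a₁<x₁ = subst (ℕ._≤ x₁) (ℕP.+-comm a₁ 1) a₁+1≤x₁
  x₁≤x₂ : x₁ ℕ.≤ x₂
  x₁≤x₂ = ℕP.≤-trans x₁≤2a₁-1 2a₁-1≤x₂
  0<a₁ : 0 ℕ.< a₁
  0<a₁ = ℕP.≤-trans (ℕ.s≤s ℕ.z≤n) 2≤a₁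
  a₁<x₂ : ℕ→ℚ a₁ < ℕ→ℚ x₂
  a₁<x₂ = ℚP.<-≤-trans (ℕ→ℚ-mono-< a₁<x₁) (ℕ→ℚ-mono-≤ x₁≤x₂)

  open CeilingCompletion {s = inv (ℕ→ℚ x₁) + inv (ℕ→ℚ x₂)} (ℤ.+<+ 0<a₁)
    (reciprocal-gap-pos (ℕ→ℚ-mono-< 0<a₁) (ℕ→ℚ-mono-< a₁<x₁)
      (ℚP.<-trans (ℕ→ℚ-mono-< 0<a₁) a₁<x₂) x₂<a₁x₁/[x₁-a₁])
    (reciprocal-gap<inv (ℕ→ℚ-mono-< 0<a₁) (ℕ→ℚ-mono-< a₁<x₁) a₁<x₂)

  egyptian : (θ : ℚ) → inv (ℕ→ℚ x₁) + inv (ℕ→ℚ x₂) < θ →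
             θ ≤ inv A + inv (ℤ→ℚ (c ℤ.- + 1)) →
             EgyptUnder2 θ (+ a₁) c × EgyptUnder2 θ (+ x₁) (+ x₂)
  egyptian θ s<θ _ =
    (ℤ.+≤+ 2≤a₁ , ℤP.<⇒≤ a<c , ℚP.≤-<-trans 1/a+1/c≤s s<θ) ,
    (ℤ.+≤+ (ℕP.≤-trans 2≤a₁ (ℕP.<⇒≤ a₁<x₁)) , ℤ.+≤+ x₁≤x₂ , s<θ)
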